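{- Let $T$ be a finite rooted tree, let $v$ be an apex node of $T$ other than the root, and let $u$ be the parent of $v$. If $wc(v)<wc(u)$ then $rld(v)=0$, and if $wc(v)=wc(u)$ then $rld(v)=rld(u)+1$.
   Context: For $x>0$, $\lg x=\max(1,\log_2 x)$. In a finite rooted tree $T$, $T_u$ is the subtree rooted at $u$ and $|T_u|$ its number of nodes. Heavy-light decomposition: for a non-leaf node $u$, $heavy(u)$ is a child $v$ of $u$ maximizing $|T_v|$ (one fixed choice); the edge $(u,heavy(u))$ is heavy and all other edges from $u$ to its children are light. A node is an apex node if it is the root or the edge to its parent is light. The light subtree of $u$ is $T_u^\ell=T_u\setminus T_{heavy(u)}$ (for a leaf, $T_u^\ell=\{u\}$). Define $\gamma(u)=\lfloor\lg|T_u|\rfloor$ if $u$ is an apex node and $\gamma(u)=\lfloor\lg|T_u^\ell|\rfloor$ otherwise, and the weight class $wc(u)=\lfloor\lg\gamma(u)\rfloor$. Let $wtop(u)$ be the ancestor of $u$ (possibly $u$ itself) of smallest depth such that every node on the path from $u$ to $wtop(u)$ has weight class $\le wc(u)$. The restricted light depth $rld(u)$ is the number of light edges on the path from $u$ to $wtop(u)$. -}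

module Defs where

open import Data.Nat using (ℕ; zero; suc; _+_; _∸_; _≤_; _⊔_; _≤ᵇ_)
open import Data.Nat.Logarithm using (⌊log₂_⌋)
open import Data.List using (List; []; _∷_; length; lookup)
open import Data.Fin using (Fin; _≟_)
open import Data.Bool using (Bool; true; false; not; if_then_else_)
open import Relation.Nullary.Decidable using (⌊_⌋)

data Tree : Set where
  node : List Tree → Tree

mutual
  size : Tree → ℕ
  size (node ts) = suc (sizes ts)

  sizes : List Tree → ℕ
  sizes []       = 0
  sizes (t ∷ ts) = size t + sizes ts

-- A node of the tree t, identified by the path from the root to it;
-- the index s is the subtree T_u rooted at that node.
-- 'step p i' is the i-th child of the node p (so p is its parent).
data Path (t : Tree) : Tree → Set where
  root : Path t t
  step : ∀ {ts} → Path t (node ts) → (i : Fin (length ts)) → Path t (lookup ts i)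

-- ⌊lg n⌋ where lg x = max(1, log₂ x)  (for n ≥ 1: ⌊max(1,log₂ n)⌋ = max(1,⌊log₂ n⌋))
flg : ℕ → ℕ
flg n = 1 ⊔ ⌊log₂ n ⌋

record HeavyChoice (t : Tree) : Set where
  field
    heavy   : ∀ {x xs} → Path t (node (x ∷ xs)) → Fin (suc (length xs))
    maximal : ∀ {x xs} (p : Path t (node (x ∷ xs))) (j : Fin (suc (length xs))) →
              size (lookup (x ∷ xs) j) ≤ size (lookup (x ∷ xs) (heavy p))

module HLD {t : Tree} (H : HeavyChoice t) where
  open HeavyChoice H

  isHeavyEdge : ∀ {ts} → Path t (node ts) → Fin (length ts) → Bool
  isHeavyEdge {x ∷ xs} p i = ⌊ i ≟ heavy p ⌋

  isApex : ∀ {s} → Path t s → Bool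
  isApex root       = true
  isApex (step p i) = not (isHeavyEdge p i)

  lightSize : ∀ {s} → Path t s → ℕ
  lightSize {node []}       p = 1
  lightSize {node (x ∷ xs)} p = size (node (x ∷ xs)) ∸ size (lookup (x ∷ xs) (heavy p))

  γ : ∀ {s} → Path t s → ℕ
  γ {s} p = if isApex p then flg (size s) else flg (lightSize p)

  wc : ∀ {s} → Path t s → ℕ
  wc p = flg (γ p)

  -- Number of light edges on the upward path from a node, continuing upward
  -- as long as the next ancestor has weight class ≤ c.  (The edge from p to
  -- step p i is light iff step p i is an apex node.)
  lightUp : ℕ → ∀ {s} → Path t s → ℕ
  lightUp c root       = 0
  lightUp c (step p i) =
    if wc p ≤ᵇ c
    then (if isApex (step p i) then 1 else 0) + lightUp c p
    else 0

  rld : ∀ {s} → Path t s → ℕ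
  rld u = lightUp (wc u) u

module Submission where

open import Defs
open import Data.Nat using (suc; _≤_; _<_; _≤ᵇ_)
open import Data.Nat.Properties using (≤ᵇ⇒≤; ≤⇒≤ᵇ; <⇒≱; ≤-reflexive)
open import Data.List using (length)
open import Data.Fin using (Fin)
open import Data.Bool using (true; false)
open import Data.Bool.Properties using (T-≡; ¬-not)
open import Data.Product using (_×_; _,_)
open import Function using (_∘_; Equivalence)
open import Relation.Binary.PropositionalEquality using (_≡_; refl; sym; cong; module ≡-Reasoning)

≤⇒≤ᵇ≡true : ∀ {m n} → m ≤ n → (m ≤ᵇ n) ≡ true
≤⇒≤ᵇ≡true = Equivalence.to T-≡ ∘ ≤⇒≤ᵇ

>⇒≤ᵇ≡false : ∀ {m n} → n < m → (m ≤ᵇ n) ≡ false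
>⇒≤ᵇ≡false {m} {n} n<m = ¬-not (<⇒≱ n<m ∘ ≤ᵇ⇒≤ m n ∘ Equivalence.from T-≡)

module _ {t : Tree} (H : HeavyChoice t) where
  open HLD H

  lightUp-step-blocked : ∀ {c ts} (p : Path t (node ts)) (i : Fin (length ts)) →
    c < wc p → lightUp c (step p i) ≡ 0
  lightUp-step-blocked p i c<wc rewrite >⇒≤ᵇ≡false c<wc = refl

  lightUp-step-apex : ∀ {c ts} (p : Path t (node ts)) (i : Fin (length ts)) →
    wc p ≤ c → isApex (step p i) ≡ true → lightUp c (step p i) ≡ suc (lightUp c p)
  lightUp-step-apex p i wc≤c apex rewrite ≤⇒≤ᵇ≡true wc≤c | apex = refl

lemma6 : (t : Tree) (H : HeavyChoice t) {ts : _} (u : Path t (node ts)) (i : Fin (length ts)) →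
    HLD.isApex H (step u i) ≡ true →
    (HLD.wc H (step u i) < HLD.wc H u → HLD.rld H (step u i) ≡ 0) ×
    (HLD.wc H (step u i) ≡ HLD.wc H u → HLD.rld H (step u i) ≡ suc (HLD.rld H u))
lemma6 t H u i apex = lightUp-step-blocked H u i , same-class
  where
  open HLD H
  open ≡-Reasoning

  same-class : wc (step u i) ≡ wc u → rld (step u i) ≡ suc (rld u)
  same-class wc≡ = begin
    lightUp (wc (step u i)) (step u i)  ≡⟨ lightUp-step-apex H u i (≤-reflexive (sym wc≡)) apex ⟩
    suc (lightUp (wc (step u i)) u)     ≡⟨ cong (λ c → suc (lightUp c u)) wc≡ ⟩
    suc (lightUp (wc u) u)              ∎
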